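{- Let $n\ge3$ be an odd integer. Then for every $\pi\in\mathsf{S}_n$ the strategic pile $\mathsf{SP}(\pi)$ has at most $n-2$ elements.
   Context: $\mathsf{S}_n$ is the set of permutations of $\{1,\dots,n\}$; $[a_1\cdots a_n]$ is one-line notation; cycles $(c_1\cdots c_k)$ send $c_1\mapsto\cdots\mapsto c_k\mapsto c_1$; composition is right-to-left. For $\pi=[a_1\cdots a_n]$ let $X_n=(0\;1\;\cdots\;n)$, $Y_\pi=(0\;a_n\;\cdots\;a_1)$, $C_\pi=Y_\pi\circ X_n$ (permutations of $\{0,\dots,n\}$). If $0$ and $n$ are in the same cycle of $C_\pi$, written $(0\;u_1\cdots u_j\;n\;b_1\cdots b_k)$, then $\mathsf{SP}(\pi)=\{b_1,\dots,b_k\}$; otherwise $\mathsf{SP}(\pi)=\emptyset$. -}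

module Defs where

open import Data.Nat using (ℕ; zero; suc; _<?_)
open import Data.Fin using (Fin; zero; suc; toℕ; fromℕ; fromℕ<; inject₁; _≟_)
open import Data.Fin.Permutation using (Permutation′; _⟨$⟩ʳ_; _⟨$⟩ˡ_)
open import Data.List using (List; []; _∷_)
open import Data.Maybe using (Maybe; just; nothing)
open import Relation.Nullary using (yes; no)

-- Points {0,…,n} are represented by Fin (suc n) (toℕ gives the number).
-- A permutation π ∈ S_n of {1,…,n} is a permutation of Fin n, where the
-- value a_i = π(i) (1 ≤ i ≤ n) is  1 + toℕ (π ⟨$⟩ʳ (i-1)).

-- the value a_{i+1} viewed as a point of {0,…,n}
val : {n : ℕ} → Permutation′ n → Fin n → Fin (suc n)
val π i = suc (π ⟨$⟩ʳ i)

X : (n : ℕ) → Fin (suc n) → Fin (suc n)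
X n x with suc (toℕ x) <? suc n
... | yes p = fromℕ< p
... | no _  = zero

-- Y_π = (0 a_n a_{n-1} ⋯ a_1) : 0 ↦ a_n, a_i ↦ a_{i-1} (i ≥ 2), a_1 ↦ 0
Y : (n : ℕ) → Permutation′ n → Fin (suc n) → Fin (suc n)
Y zero    π x       = x
Y (suc m) π zero    = val π (fromℕ m)
Y (suc m) π (suc v) with π ⟨$⟩ˡ v
... | zero  = zero
... | suc j = val π (inject₁ j)

C : (n : ℕ) → Permutation′ n → Fin (suc n) → Fin (suc n)
C n π x = Y n π (X n x)

walkTo0 : {n : ℕ} → ℕ → (Fin (suc n) → Fin (suc n)) → Fin (suc n) → Maybe (List (Fin (suc n)))
walkTo0 fuel    f zero    = just []
walkTo0 zero    f (suc x) = nothing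
walkTo0 (suc k) f (suc x) with walkTo0 k f (f (suc x))
... | just l  = just (suc x ∷ l)
... | nothing = nothing

-- Strategic pile: if the cycle of C_π through n is (0 u_1⋯u_j n b_1⋯b_k),
-- SP(π) lists b_1,…,b_k (the points after n before returning to 0);
-- otherwise it is empty.  The cycle of n has length ≤ n+1, so n+1 steps
-- from C_π(n) suffice to reach 0 whenever 0 lies in the cycle of n.
SP : (n : ℕ) → Permutation′ n → List (Fin (suc n))
SP n π with walkTo0 (suc n) (C n π) (C n π (fromℕ n))
... | just l  = l
... | nothing = []

-- If SP(π) had at least n − 1 elements, the cycle of C_π through n would
-- contain n, the points of SP(π) and 0, i.e. all n + 1 points, so C_π would
-- be an (n + 1)-cycle and hence an odd permutation for odd n.  But
-- C_π = Y_π ∘ X_n is a product of two (n + 1)-cycles, hence even.  Parity is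
-- measured by the number of inversions, whose parity is additive under
-- composition.

module Submission where

open import Defs
open import Data.Bool.Base using (Bool; true; false; not; _∧_)
open import Data.Fin.Base using (Fin; zero; suc; toℕ; fromℕ; inject₁; punchOut)
open import Data.Fin.Permutation
  using (Permutation′; permutation; lift₀; flip; _⟨$⟩ʳ_; _⟨$⟩ˡ_; inverseˡ; inverseʳ)
open import Data.Fin.Properties
  using (_≟_; toℕ-injective; toℕ-fromℕ; toℕ-fromℕ<; toℕ-inject₁; inject₁ℕ<; toℕ≤pred[n];
         any?; pigeonhole; punchOut-injective; <⇒≢)
open import Data.Fin.Relation.Unary.Top using (view; ‵fromℕ; ‵inj₁)
open import Data.List.Base using (length)
open import Data.Maybe.Base using (just; nothing)
open import Data.Nat.Base using (ℕ; zero; suc; _+_; _*_; _∸_; _≤_; _<_; _<ᵇ_; z≤n; s≤s; parity; ⌊_/2⌋)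
open import Data.Nat.Properties
  using (_<?_; _≤?_; <-cmp; <-irrefl; ≤-trans; ≤-refl; <⇒≤; ≰⇒>; n<1+n; +-comm; +-identityʳ;
         m∸n≤m; m∸n+n≡m; m+[n∸m]≡n; ∸-monoʳ-≤; m<n⇒0<n∸m; n≡⌊n+n/2⌋; +-0-commutativeMonoid)
open import Algebra.Properties.CommutativeMonoid.Sum +-0-commutativeMonoid
  using (sum; sum-permute; ∑-distrib-+; ∑-comm; sum-cong-≗; sum-replicate-zero)
open import Data.Nat.GeneralisedArithmetic using (iterate)
open import Data.Parity.Base using (Parity; 0ℙ; 1ℙ) renaming (_+_ to _⊕_)
open import Data.Parity.Properties
  using (p+p≡0ℙ; +-cancelˡ-≡)
  renaming (+-homo-+ to parity-homo-+; *-homo-* to parity-homo-*; +-identityʳ to ⊕-identityʳ;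
            +-comm to ⊕-comm)
open import Data.Product.Base using (∃; _,_; proj₁; proj₂; _×_)
open import Function.Base using (_∘_; id)
open import Function.Bundles using (Injection)
open import Function.Definitions using (Injective)
open import Function.Properties.Inverse using (↔⇒↣)
open import Relation.Binary.Definitions using (tri<; tri≈; tri>)
open import Relation.Binary.PropositionalEquality
  using (_≡_; _≢_; refl; sym; trans; cong; cong₂; _≗_; module ≡-Reasoning)
open import Relation.Nullary using (yes; no; contradiction)

open ≡-Reasoning

𝟙 : Bool → ℕ
𝟙 true  = 1
𝟙 false = 0

𝟙-not-partition : ∀ b x → 𝟙 (not b) * x + 𝟙 b * x ≡ x
𝟙-not-partition true  x = +-identityʳ x
𝟙-not-partition false x = trans (+-identityʳ (x + 0)) (+-identityʳ x)

+-double-injective : ∀ {m n} → m + m ≡ n + n → m ≡ n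
+-double-injective {m} {n} eq = trans (n≡⌊n+n/2⌋ m) (trans (cong ⌊_/2⌋ eq) (sym (n≡⌊n+n/2⌋ n)))

p≡p⊕q⊕q : ∀ p q → p ≡ p ⊕ q ⊕ q
p≡p⊕q⊕q 0ℙ 0ℙ = refl
p≡p⊕q⊕q 0ℙ 1ℙ = refl
p≡p⊕q⊕q 1ℙ 0ℙ = refl
p≡p⊕q⊕q 1ℙ 1ℙ = refl

permutation-injective : ∀ {N} (ρ : Permutation′ N) → Injective _≡_ _≡_ (ρ ⟨$⟩ʳ_)
permutation-injective ρ = Injection.injective (↔⇒↣ ρ)

<ᵇ-irrefl : ∀ m → (m <ᵇ m) ≡ false
<ᵇ-irrefl zero    = refl
<ᵇ-irrefl (suc m) = <ᵇ-irrefl m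

<ᵇ-asym : ∀ m n → ((m <ᵇ n) ∧ (n <ᵇ m)) ≡ false
<ᵇ-asym zero    zero    = refl
<ᵇ-asym zero    (suc n) = refl
<ᵇ-asym (suc m) zero    = refl
<ᵇ-asym (suc m) (suc n) = <ᵇ-asym m n

<ᵇ-total : ∀ m n → m ≢ n → (m <ᵇ n) ≡ not (n <ᵇ m)
<ᵇ-total zero    zero    m≢n = contradiction refl m≢n
<ᵇ-total zero    (suc n) _   = refl
<ᵇ-total (suc m) zero    _   = refl
<ᵇ-total (suc m) (suc n) m≢n = <ᵇ-total m n (m≢n ∘ cong suc)

infix 4 _≺_

_≺_ : ∀ {N} → Fin N → Fin N → Bool
i ≺ j = toℕ i <ᵇ toℕ j

≺-irrefl : ∀ {N} (i : Fin N) → (i ≺ i) ≡ false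
≺-irrefl i = <ᵇ-irrefl (toℕ i)

≺-total : ∀ {N} {i j : Fin N} → i ≢ j → (i ≺ j) ≡ not (j ≺ i)
≺-total {i = i} {j} i≢j = <ᵇ-total (toℕ i) (toℕ j) (i≢j ∘ toℕ-injective)

≺⇒≢ : ∀ {N} {i j : Fin N} → (i ≺ j) ≡ true → i ≢ j
≺⇒≢ {i = i} i≺i refl = contradiction (trans (sym i≺i) (≺-irrefl i)) λ ()

inject₁-≺ : ∀ {N} (i j : Fin N) → (inject₁ i ≺ inject₁ j) ≡ (i ≺ j)
inject₁-≺ i j = cong₂ _<ᵇ_ (toℕ-inject₁ i) (toℕ-inject₁ j)

inject₁≺fromℕ : ∀ {N} (j : Fin N) → (inject₁ j ≺ fromℕ N) ≡ true
inject₁≺fromℕ zero    = refl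
inject₁≺fromℕ (suc j) = inject₁≺fromℕ j

sum-ones : ∀ N → sum {N} (λ _ → 1) ≡ N
sum-ones zero    = refl
sum-ones (suc N) = cong suc (sum-ones N)

sum₂ : ∀ {N} → (Fin N → Fin N → ℕ) → ℕ
sum₂ W = sum (λ i → sum (W i))

sum₂-cong : ∀ {N} {V W : Fin N → Fin N → ℕ} → (∀ i j → V i j ≡ W i j) → sum₂ V ≡ sum₂ W
sum₂-cong V≡W = sum-cong-≗ λ i → sum-cong-≗ (V≡W i)

sum₂-zero : ∀ {N} {W : Fin N → Fin N → ℕ} → (∀ i j → W i j ≡ 0) → sum₂ W ≡ 0
sum₂-zero {N} {W} W≡0 = begin
  sum₂ W                       ≡⟨ sum₂-cong W≡0 ⟩
  sum {N} (λ _ → sum {N} (λ _ → 0)) ≡⟨ sum-cong-≗ {N} (λ _ → sum-replicate-zero N) ⟩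
  sum {N} (λ _ → 0)            ≡⟨ sum-replicate-zero N ⟩
  0                            ∎

sum₂-+ : ∀ {N} (V W : Fin N → Fin N → ℕ) → sum₂ (λ i j → V i j + W i j) ≡ sum₂ V + sum₂ W
sum₂-+ V W = trans (sum-cong-≗ λ i → ∑-distrib-+ (V i) (W i))
                   (∑-distrib-+ (λ i → sum (V i)) (λ i → sum (W i)))

sum₂-transpose : ∀ {N} (W : Fin N → Fin N → ℕ) → sum₂ (λ i j → W j i) ≡ sum₂ W
sum₂-transpose W = ∑-comm (λ i j → W j i)

sum₂-permute : ∀ {N} (g : Permutation′ N) (W : Fin N → Fin N → ℕ) →
               sum₂ (λ i j → W (g ⟨$⟩ʳ i) (g ⟨$⟩ʳ j)) ≡ sum₂ W
sum₂-permute g W = sym (trans (sum-permute (λ a → sum (W a)) g)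
                              (sum-cong-≗ λ i → sum-permute (W (g ⟨$⟩ʳ i)) g))

sum₂-upper-triangle : ∀ {N} (W : Fin N → Fin N → ℕ) →
                      (∀ i j → W i j ≡ W j i) → (∀ i → W i i ≡ 0) →
                      sum₂ (λ i j → 𝟙 (i ≺ j) * W i j) + sum₂ (λ i j → 𝟙 (i ≺ j) * W i j) ≡ sum₂ W
sum₂-upper-triangle W W-sym W-diag = begin
  sum₂ U + sum₂ U                    ≡⟨ cong (sum₂ U +_) (sym (sum₂-transpose U)) ⟩
  sum₂ U + sum₂ (λ i j → U j i)      ≡⟨ sym (sum₂-+ U (λ i j → U j i)) ⟩
  sum₂ (λ i j → U i j + U j i)       ≡⟨ sum₂-cong split ⟩
  sum₂ W                             ∎
  where
  U = λ i j → 𝟙 (i ≺ j) * W i j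
  split : ∀ i j → U i j + U j i ≡ W i j
  split i j with i ≟ j
  ... | yes refl rewrite W-diag i | ≺-irrefl i = refl
  ... | no i≢j rewrite ≺-total i≢j | W-sym j i = 𝟙-not-partition (j ≺ i) (W i j)

inverted : ∀ {N} → (Fin N → Fin N) → Fin N → Fin N → Bool
inverted h i j = (i ≺ j) ∧ (h j ≺ h i)

inversions : ∀ {N} → (Fin N → Fin N) → ℕ
inversions h = sum₂ (λ i j → 𝟙 (inverted h i j))

sgn : ∀ {N} → (Fin N → Fin N) → Parity
sgn h = parity (inversions h)

sgn-cong : ∀ {N} {f g : Fin N → Fin N} → f ≗ g → sgn f ≡ sgn g
sgn-cong f≗g = cong parity (sum₂-cong λ i j → cong₂ (λ a b → 𝟙 ((i ≺ j) ∧ (a ≺ b))) (f≗g j) (f≗g i))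

inversions-id : ∀ {N} → inversions {N} id ≡ 0
inversions-id {N} = sum₂-zero {N} (λ i j → cong 𝟙 (<ᵇ-asym (toℕ i) (toℕ j)))

discord : ∀ {N} → (Fin N → Fin N) → Fin N → Fin N → ℕ
discord h a b = 𝟙 (inverted h a b) + 𝟙 (inverted h b a)

discord-sym : ∀ {N} (h : Fin N → Fin N) a b → discord h a b ≡ discord h b a
discord-sym h a b = +-comm (𝟙 (inverted h a b)) (𝟙 (inverted h b a))

discord-diag : ∀ {N} (h : Fin N → Fin N) a → discord h a a ≡ 0
discord-diag h a rewrite ≺-irrefl a = refl

sum₂-discord : ∀ {N} (h : Fin N → Fin N) → sum₂ (discord h) ≡ inversions h + inversions h
sum₂-discord h = trans (sum₂-+ (λ a b → 𝟙 (inverted h a b)) (λ a b → 𝟙 (inverted h b a)))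
                       (cong (inversions h +_) (sum₂-transpose (λ a b → 𝟙 (inverted h a b))))

-- Once u = not v and q = not p, this is p + v = (p xor v) + 2 (p ∧ v).
𝟙-∧-split : ∀ l u v p q → (l ≡ true → u ≡ not v) → (l ≡ true → q ≡ not p) →
            𝟙 (l ∧ p) + 𝟙 (l ∧ v) ≡
            𝟙 l * (𝟙 (u ∧ p) + 𝟙 (v ∧ q)) + (𝟙 (l ∧ v ∧ p) + 𝟙 (l ∧ v ∧ p))
𝟙-∧-split false u v p q _ _ = refl
𝟙-∧-split true  u v p q u≡¬v q≡¬p rewrite u≡¬v refl | q≡¬p refl = split v p
  where
  split : ∀ v p → 𝟙 p + 𝟙 v ≡ (𝟙 (not v ∧ p) + 𝟙 (v ∧ not p) + 0) + (𝟙 (v ∧ p) + 𝟙 (v ∧ p))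
  split false false = refl
  split false true  = refl
  split true  false = refl
  split true  true  = refl

inversions-∘ : ∀ {N} (f : Fin N → Fin N) (g : Permutation′ N) → Injective _≡_ _≡_ f →
               ∃ λ K → inversions (f ∘ (g ⟨$⟩ʳ_)) + inversions (g ⟨$⟩ʳ_) ≡ inversions f + (K + K)
inversions-∘ {N} f g f-inj = sum₂ both , (begin
  inversions (f ∘ gʳ) + inversions gʳ
    ≡⟨ sym (sum₂-+ (λ i j → 𝟙 (inverted (f ∘ gʳ) i j)) (λ i j → 𝟙 (inverted gʳ i j))) ⟩
  sum₂ (λ i j → 𝟙 (inverted (f ∘ gʳ) i j) + 𝟙 (inverted gʳ i j))
    ≡⟨ sum₂-cong pointwise ⟩
  sum₂ (λ i j → U i j + (both i j + both i j))
    ≡⟨ sum₂-+ U (λ i j → both i j + both i j) ⟩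
  sum₂ U + sum₂ (λ i j → both i j + both i j)
    ≡⟨ cong₂ _+_ sum₂-U (sum₂-+ both both) ⟩
  inversions f + (sum₂ both + sum₂ both)
    ∎)
  where
  gʳ : Fin N → Fin N
  gʳ = g ⟨$⟩ʳ_
  g-inj : Injective _≡_ _≡_ gʳ
  g-inj = permutation-injective g
  U both : Fin N → Fin N → ℕ
  U i j = 𝟙 (i ≺ j) * discord f (gʳ i) (gʳ j)
  both i j = 𝟙 ((i ≺ j) ∧ (gʳ j ≺ gʳ i) ∧ (f (gʳ j) ≺ f (gʳ i)))
  pointwise : ∀ i j → 𝟙 (inverted (f ∘ gʳ) i j) + 𝟙 (inverted gʳ i j) ≡ U i j + (both i j + both i j)
  pointwise i j = 𝟙-∧-split (i ≺ j) _ _ _ _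
    (λ i≺j → ≺-total (≺⇒≢ i≺j ∘ g-inj))
    (λ i≺j → ≺-total (≺⇒≢ i≺j ∘ g-inj ∘ f-inj))
  sum₂-U : sum₂ U ≡ inversions f
  sum₂-U = +-double-injective (begin
    sum₂ U + sum₂ U                          ≡⟨ sum₂-upper-triangle (λ a b → discord f (gʳ a) (gʳ b))
                                                  (λ a b → discord-sym f (gʳ a) (gʳ b)) (discord-diag f ∘ gʳ) ⟩
    sum₂ (λ i j → discord f (gʳ i) (gʳ j))   ≡⟨ sum₂-permute g (discord f) ⟩
    sum₂ (discord f)                         ≡⟨ sum₂-discord f ⟩
    inversions f + inversions f              ∎)

sgn-∘ : ∀ {N} (f : Fin N → Fin N) (g : Permutation′ N) → Injective _≡_ _≡_ f →
        sgn (f ∘ (g ⟨$⟩ʳ_)) ≡ sgn f ⊕ sgn (g ⟨$⟩ʳ_)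
sgn-∘ {N} f g f-inj with K , eq ← inversions-∘ f g f-inj =
  trans (p≡p⊕q⊕q (sgn fg) (sgn gʳ)) (cong (_⊕ sgn gʳ) (begin
  sgn fg ⊕ sgn gʳ                          ≡⟨ sym (parity-homo-+ (inversions fg) (inversions gʳ)) ⟩
  parity (inversions fg + inversions gʳ)   ≡⟨ cong parity eq ⟩
  parity (inversions f + (K + K))          ≡⟨ parity-homo-+ (inversions f) (K + K) ⟩
  sgn f ⊕ parity (K + K)                   ≡⟨ cong (sgn f ⊕_) (trans (parity-homo-+ K K) (p+p≡0ℙ (parity K))) ⟩
  sgn f ⊕ 0ℙ                               ≡⟨ ⊕-identityʳ (sgn f) ⟩
  sgn f                                    ∎))
  where
  gʳ fg : Fin N → Fin N
  gʳ = g ⟨$⟩ʳ_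
  fg = f ∘ gʳ

conjugate-injective : ∀ {N} (f : Fin N → Fin N) (τ g : Permutation′ N) →
                      (∀ j → f (τ ⟨$⟩ʳ j) ≡ τ ⟨$⟩ʳ (g ⟨$⟩ʳ j)) → Injective _≡_ _≡_ f
conjugate-injective f τ g conj {a} {b} fa≡fb = begin
  a                     ≡⟨ sym (inverseʳ τ) ⟩
  τ ⟨$⟩ʳ (τ ⟨$⟩ˡ a)     ≡⟨ cong (τ ⟨$⟩ʳ_) (permutation-injective g (permutation-injective τ (begin
     τ ⟨$⟩ʳ (g ⟨$⟩ʳ (τ ⟨$⟩ˡ a)) ≡⟨ sym (conj _) ⟩
     f (τ ⟨$⟩ʳ (τ ⟨$⟩ˡ a))      ≡⟨ cong f (inverseʳ τ) ⟩
     f a                        ≡⟨ fa≡fb ⟩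
     f b                        ≡⟨ cong f (sym (inverseʳ τ)) ⟩
     f (τ ⟨$⟩ʳ (τ ⟨$⟩ˡ b))      ≡⟨ conj _ ⟩
     τ ⟨$⟩ʳ (g ⟨$⟩ʳ (τ ⟨$⟩ˡ b)) ∎))) ⟩
  τ ⟨$⟩ʳ (τ ⟨$⟩ˡ b)     ≡⟨ inverseʳ τ ⟩
  b                     ∎

sgn-conjugate : ∀ {N} (f : Fin N → Fin N) (τ g : Permutation′ N) →
                (∀ j → f (τ ⟨$⟩ʳ j) ≡ τ ⟨$⟩ʳ (g ⟨$⟩ʳ j)) → sgn f ≡ sgn (g ⟨$⟩ʳ_)
sgn-conjugate {N} f τ g conj = +-cancelˡ-≡ (sgn (τ ⟨$⟩ʳ_)) _ _ (begin
  sgn τʳ ⊕ sgn f           ≡⟨ ⊕-comm (sgn τʳ) (sgn f) ⟩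
  sgn f ⊕ sgn τʳ           ≡⟨ sym (sgn-∘ f τ (conjugate-injective f τ g conj)) ⟩
  sgn (f ∘ τʳ)             ≡⟨ sgn-cong conj ⟩
  sgn (τʳ ∘ (g ⟨$⟩ʳ_))      ≡⟨ sgn-∘ τʳ g (permutation-injective τ) ⟩
  sgn τʳ ⊕ sgn (g ⟨$⟩ʳ_)    ∎)
  where
  τʳ : Fin N → Fin N
  τʳ = τ ⟨$⟩ʳ_

injective⇒surjective : ∀ {n} {f : Fin (suc n) → Fin (suc n)} → Injective _≡_ _≡_ f →
                       ∀ y → ∃ λ x → f x ≡ y
injective⇒surjective {n} {f} f-inj y with any? (λ x → f x ≟ y)
... | yes hit = hit
... | no miss with i , j , i<j , eq ← pigeonhole (n<1+n n) (λ x → punchOut {i = y} {j = f x} (miss ∘ (x ,_) ∘ sym))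
  = contradiction (f-inj (punchOut-injective (miss ∘ (i ,_) ∘ sym) (miss ∘ (j ,_) ∘ sym) eq)) (<⇒≢ i<j)

injective⇒permutation : ∀ {n} (f : Fin (suc n) → Fin (suc n)) → Injective _≡_ _≡_ f → Permutation′ (suc n)
injective⇒permutation f f-inj =
  permutation f (proj₁ ∘ surj) (proj₂ ∘ surj) (λ x → f-inj (proj₂ (surj (f x))))
  where
  surj : ∀ y → ∃ λ x → f x ≡ y
  surj = injective⇒surjective f-inj

X-inject₁ : ∀ n (i : Fin n) → X n (inject₁ i) ≡ suc i
X-inject₁ n i with suc (toℕ (inject₁ i)) <? suc n
... | yes lt  = toℕ-injective (trans (toℕ-fromℕ< lt) (cong suc (toℕ-inject₁ i)))
... | no ¬lt = contradiction (s≤s (inject₁ℕ< i)) ¬lt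

X-fromℕ : ∀ n → X n (fromℕ n) ≡ zero
X-fromℕ n with suc (toℕ (fromℕ n)) <? suc n
... | yes (s≤s lt) = contradiction lt (<-irrefl (toℕ-fromℕ n))
... | no _         = refl

X⁻¹ : ∀ n → Fin (suc n) → Fin (suc n)
X⁻¹ n zero    = fromℕ n
X⁻¹ n (suc i) = inject₁ i

X∘X⁻¹ : ∀ n y → X n (X⁻¹ n y) ≡ y
X∘X⁻¹ n zero    = X-fromℕ n
X∘X⁻¹ n (suc i) = X-inject₁ n i

X⁻¹∘X : ∀ n x → X⁻¹ n (X n x) ≡ x
X⁻¹∘X n x with view x
... | ‵fromℕ          = cong (X⁻¹ n) (X-fromℕ n)
... | ‵inj₁ {i = i} _ = cong (X⁻¹ n) (X-inject₁ n i)

cycleₚ : ∀ n → Permutation′ (suc n)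
cycleₚ n = permutation (X n) (X⁻¹ n) (X∘X⁻¹ n) (X⁻¹∘X n)

inversions-X⁻¹ : ∀ n → inversions (X⁻¹ n) ≡ n
inversions-X⁻¹ n = begin
  sum (λ j → 𝟙 (inverted (X⁻¹ n) zero j)) + sum (λ i → sum (λ j → 𝟙 (inverted (X⁻¹ n) (suc i) j)))
    ≡⟨ cong₂ _+_ first-row (trans (sum-cong-≗ λ i → later-row i) (sum-replicate-zero n)) ⟩
  n + 0
    ≡⟨ +-identityʳ n ⟩
  n ∎
  where
  first-row : sum {n} (λ j → 𝟙 (inject₁ j ≺ fromℕ n)) ≡ n
  first-row = trans (sum-cong-≗ {n} λ j → cong 𝟙 (inject₁≺fromℕ j)) (sum-ones n)
  later-entry : ∀ i j → 𝟙 (inverted (X⁻¹ n) (suc i) j) ≡ 0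
  later-entry i zero    = refl
  later-entry i (suc j) rewrite inject₁-≺ j i = cong 𝟙 (<ᵇ-asym (toℕ i) (toℕ j))
  later-row : ∀ i → sum (λ j → 𝟙 (inverted (X⁻¹ n) (suc i) j)) ≡ 0
  later-row i = trans (sum-cong-≗ (later-entry i)) (sum-replicate-zero (suc n))

sgn-X⁻¹ : ∀ n → sgn (X⁻¹ n) ≡ parity n
sgn-X⁻¹ n = cong parity (inversions-X⁻¹ n)

-- The inversions of X⁻¹ are simply the pairs (0, j), so sgn X is reached through X⁻¹ ∘ X = id.
sgn-X : ∀ n → sgn (X n) ≡ parity n
sgn-X n = trans (+-cancelˡ-≡ (sgn (X⁻¹ n)) _ _ (begin
  sgn (X⁻¹ n) ⊕ sgn (X n)      ≡⟨ sgn-∘ (X⁻¹ n) (cycleₚ n) (permutation-injective (flip (cycleₚ n))) ⟨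
  sgn (X⁻¹ n ∘ X n)            ≡⟨ sgn-cong (X⁻¹∘X n) ⟩
  sgn {suc n} id               ≡⟨ cong parity (inversions-id {suc n}) ⟩
  0ℙ                           ≡⟨ sym (p+p≡0ℙ (sgn (X⁻¹ n))) ⟩
  sgn (X⁻¹ n) ⊕ sgn (X⁻¹ n)    ∎)) (sgn-X⁻¹ n)

Y-conjugate : ∀ m (π : Permutation′ (suc m)) j →
              Y (suc m) π (lift₀ π ⟨$⟩ʳ j) ≡ lift₀ π ⟨$⟩ʳ (X⁻¹ (suc m) j)
Y-conjugate m π zero    = refl
Y-conjugate m π (suc i) with π ⟨$⟩ˡ (π ⟨$⟩ʳ i) | inverseˡ π {i}
... | zero  | refl = refl
... | suc _ | refl = refl

Y-injective : ∀ m (π : Permutation′ (suc m)) → Injective _≡_ _≡_ (Y (suc m) π)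
Y-injective m π = conjugate-injective (Y (suc m) π) (lift₀ π) (flip (cycleₚ (suc m))) (Y-conjugate m π)

sgn-Y : ∀ m (π : Permutation′ (suc m)) → sgn (Y (suc m) π) ≡ parity (suc m)
sgn-Y m π = trans (sgn-conjugate (Y (suc m) π) (lift₀ π) (flip (cycleₚ (suc m))) (Y-conjugate m π))
                  (sgn-X⁻¹ (suc m))

C-injective : ∀ m (π : Permutation′ (suc m)) → Injective _≡_ _≡_ (C (suc m) π)
C-injective m π = permutation-injective (cycleₚ (suc m)) ∘ Y-injective m π

sgn-C : ∀ m (π : Permutation′ (suc m)) → sgn (C (suc m) π) ≡ 0ℙ
sgn-C m π = begin
  sgn (C (suc m) π)                     ≡⟨ sgn-∘ (Y (suc m) π) (cycleₚ (suc m)) (Y-injective m π) ⟩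
  sgn (Y (suc m) π) ⊕ sgn (X (suc m))   ≡⟨ cong₂ _⊕_ (sgn-Y m π) (sgn-X (suc m)) ⟩
  parity (suc m) ⊕ parity (suc m)       ≡⟨ p+p≡0ℙ (parity (suc m)) ⟩
  0ℙ                                    ∎

iterate-+ : ∀ {A : Set} (f : A → A) x m n → iterate f x (m + n) ≡ iterate f (iterate f x m) n
iterate-+ f x zero    n = refl
iterate-+ f x (suc m) n = iterate-+ f (f x) m n

iterate-suc : ∀ {A : Set} (f : A → A) x n → iterate f x (suc n) ≡ f (iterate f x n)
iterate-suc f x zero    = refl
iterate-suc f x (suc n) = iterate-suc f (f x) n

iterate-injective : ∀ {A : Set} {f : A → A} → Injective _≡_ _≡_ f →
                    ∀ n → Injective _≡_ _≡_ (λ x → iterate f x n)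
iterate-injective f-inj zero    eq = eq
iterate-injective f-inj (suc n) eq = f-inj (iterate-injective f-inj n eq)

firstHit⇒noReturn : ∀ {A : Set} (f : A → A) x y L → iterate f x (suc L) ≡ y →
                    (∀ r → r ≤ L → iterate f x r ≢ y) →
                    ∀ i → 1 ≤ i → i ≤ suc L → iterate f x i ≢ x
firstHit⇒noReturn f x y L hit miss i 1≤i i≤1+L return =
  miss (suc L ∸ i) (∸-monoʳ-≤ (suc L) 1≤i) (begin
  iterate f x (suc L ∸ i)                ≡⟨ cong (λ z → iterate f z (suc L ∸ i)) (sym return) ⟩
  iterate f (iterate f x i) (suc L ∸ i)  ≡⟨ sym (iterate-+ f x i (suc L ∸ i)) ⟩
  iterate f x (i + (suc L ∸ i))          ≡⟨ cong (iterate f x) (m+[n∸m]≡n i≤1+L) ⟩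
  iterate f x (suc L)                    ≡⟨ hit ⟩
  y                                      ∎)

module LongOrbit {n : ℕ} (f : Fin (suc n) → Fin (suc n)) (f-inj : Injective _≡_ _≡_ f) (x : Fin (suc n))
                 (noReturn : ∀ i → 1 ≤ i → i ≤ n → iterate f x i ≢ x) where

  iterate-distinct : ∀ {a b} → a < b → b ≤ n → iterate f x a ≢ iterate f x b
  iterate-distinct {a} {b} a<b b≤n eq =
    noReturn (b ∸ a) (m<n⇒0<n∸m a<b) (≤-trans (m∸n≤m b a) b≤n) (sym (iterate-injective f-inj a (begin
      iterate f x a                        ≡⟨ eq ⟩
      iterate f x b                        ≡⟨ cong (iterate f x) (sym (m∸n+n≡m (<⇒≤ a<b))) ⟩
      iterate f x (b ∸ a + a)              ≡⟨ iterate-+ f x (b ∸ a) a ⟩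
      iterate f (iterate f x (b ∸ a)) a    ∎)))

  orbit : Fin (suc n) → Fin (suc n)
  orbit j = iterate f x (toℕ j)

  orbit-injective : Injective _≡_ _≡_ orbit
  orbit-injective {j} {k} eq with <-cmp (toℕ j) (toℕ k)
  ... | tri< j<k _ _ = contradiction eq (iterate-distinct j<k (toℕ≤pred[n] k))
  ... | tri≈ _ j≡k _ = toℕ-injective j≡k
  ... | tri> _ _ k<j = contradiction (sym eq) (iterate-distinct k<j (toℕ≤pred[n] j))

  iterate-period : iterate f x (suc n) ≡ x
  iterate-period with injective⇒surjective orbit-injective (iterate f x (suc n))
  ... | j , hit with toℕ j | toℕ≤pred[n] j
  ... | zero  | _   = sym hit
  ... | suc t | t<n = contradiction
    (f-inj (trans (sym (iterate-suc f x t)) (trans hit (iterate-suc f x n))))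
    (iterate-distinct t<n ≤-refl)

  orbit-shift : ∀ j → f (orbit j) ≡ orbit (X n j)
  orbit-shift j with view j
  ... | ‵fromℕ = begin
    f (iterate f x (toℕ (fromℕ n)))  ≡⟨ cong (f ∘ iterate f x) (toℕ-fromℕ n) ⟩
    f (iterate f x n)                ≡⟨ sym (iterate-suc f x n) ⟩
    iterate f x (suc n)              ≡⟨ iterate-period ⟩
    x                                ≡⟨ cong orbit (sym (X-fromℕ n)) ⟩
    orbit (X n (fromℕ n))            ∎
  ... | ‵inj₁ {i = i} _ = begin
    f (iterate f x (toℕ (inject₁ i)))  ≡⟨ cong (f ∘ iterate f x) (toℕ-inject₁ i) ⟩
    f (iterate f x (toℕ i))            ≡⟨ sym (iterate-suc f x (toℕ i)) ⟩
    orbit (suc i)                      ≡⟨ cong orbit (sym (X-inject₁ n i)) ⟩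
    orbit (X n (inject₁ i))            ∎

  sgn≡parity : sgn f ≡ parity n
  sgn≡parity = trans (sgn-conjugate f (injective⇒permutation orbit orbit-injective) (cycleₚ n) orbit-shift)
                     (sgn-X n)

walkTo0-just : ∀ {n} fuel (f : Fin (suc n) → Fin (suc n)) x {l} → walkTo0 fuel f x ≡ just l →
               iterate f x (length l) ≡ zero × (∀ r → r < length l → iterate f x r ≢ zero)
walkTo0-just fuel    f zero    refl = refl , λ _ ()
walkTo0-just zero    f (suc x) ()
walkTo0-just (suc k) f (suc x) eq with walkTo0 k f (f (suc x)) in walk
walkTo0-just (suc k) f (suc x) refl | just l = proj₁ rest , miss
  where
  rest : iterate f (f (suc x)) (length l) ≡ zero × (∀ r → r < length l → iterate f (f (suc x)) r ≢ zero)
  rest = walkTo0-just k f (f (suc x)) walk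
  miss : ∀ r → r < suc (length l) → iterate f (suc x) r ≢ zero
  miss zero    _         = λ ()
  miss (suc r) (s≤s r<L) = proj₂ rest r r<L
walkTo0-just (suc k) f (suc x) () | nothing

parity-odd : ∀ k → parity (suc (2 * k)) ≡ 1ℙ
parity-odd k = trans (parity-homo-+ 1 (2 * k)) (cong (1ℙ ⊕_) (parity-homo-* 2 k))

corollary3p2 : (n : ℕ) → 3 ≤ n → ∃ (λ k → n ≡ suc (2 * k)) →
               (π : Permutation′ n) → length (SP n π) ≤ n ∸ 2
corollary3p2 (suc zero) (s≤s ()) _ _
corollary3p2 n@(suc (suc m)) _ (k , n-odd) π with walkTo0 (suc n) (C n π) (C n π (fromℕ n)) in walk
... | nothing = z≤n
... | just l with length l ≤? m
...   | yes L≤m = L≤m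
...   | no L≰m = contradiction (begin
  0ℙ                      ≡⟨ sym (sgn-C (suc m) π) ⟩
  sgn (C n π)             ≡⟨ LongOrbit.sgn≡parity (C n π) (C-injective (suc m) π) (fromℕ n) noReturn ⟩
  parity n                ≡⟨ cong parity n-odd ⟩
  parity (suc (2 * k))    ≡⟨ parity-odd k ⟩
  1ℙ                      ∎) λ ()
  where
  reach : iterate (C n π) (C n π (fromℕ n)) (length l) ≡ zero ×
          (∀ r → r < length l → iterate (C n π) (C n π (fromℕ n)) r ≢ zero)
  reach = walkTo0-just (suc n) (C n π) (C n π (fromℕ n)) walk
  miss : ∀ r → r ≤ length l → iterate (C n π) (fromℕ n) r ≢ zero
  miss zero    _   = λ ()
  miss (suc r) r<L = proj₂ reach r r<L
  noReturn : ∀ i → 1 ≤ i → i ≤ n → iterate (C n π) (fromℕ n) i ≢ fromℕ n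
  noReturn i 1≤i i≤n =
    firstHit⇒noReturn (C n π) (fromℕ n) zero (length l) (proj₁ reach) miss
                      i 1≤i (≤-trans i≤n (s≤s (≰⇒> L≰m)))
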